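{- Let $p \equiv 3 \pmod 4$ be a prime and $r$ an odd positive integer. There are infinitely many even positive integers $n$ and infinitely many odd positive integers $n$ such that $S_n^2(X_1,\dots,X_n)$ can be computed by a homogeneous $\Sigma\Pi\Sigma$ circuit over $\mathrm{GF}(p^r)$ using $\lceil\frac{n}{2}\rceil$ multiplication gates.
   Context: $S_n^2(X_1,\dots,X_n) = \sum_{1\le i<j\le n} X_iX_j$. A $\Sigma\Pi\Sigma$ circuit over a field $\mathbb{F}$ in variables $X_1,\dots,X_n$ is an expression $\sum_{i=1}^r \prod_{j=1}^{s_i} L_{ij}(X)$ where each $L_{ij}$ is a linear form $a_0+\sum_{k=1}^n a_kX_k$ with $a_0,\dots,a_n\in\mathbb{F}$; the number of products is its number of multiplication gates. It is homogeneous if every $L_{ij}$ has constant term $0$. It computes a polynomial $P$ if the expression equals $P$ in $\mathbb{F}[X_1,\dots,X_n]$. -}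

module Defs where

open import Level using (Level; _⊔_)
open import Algebra.Bundles using (CommutativeRing)
open import Data.Nat as ℕ using (ℕ; zero; suc)
open import Data.Fin as Fin using (Fin; _<?_)
open import Data.Fin.Properties as FinP using ()
open import Data.List as List using (List; []; _∷_; _++_; concatMap; map; foldr; allFin)
open import Data.Vec as Vec using (Vec; tabulate; zipWith; replicate; lookup)
open import Data.Vec.Properties using (≡-dec)
open import Data.Product using (Σ; _×_; _,_)
open import Data.Bool using (if_then_else_)
open import Relation.Nullary using (¬_; does)
open import Relation.Binary.PropositionalEquality using (_≡_)

module _ {c ℓ : Level} (R : CommutativeRing c ℓ) where
  open CommutativeRing R

  IsField : Set (c ⊔ ℓ)
  IsField = (¬ (0# ≈ 1#)) × (∀ x → ¬ (x ≈ 0#) → Σ Carrier λ y → x * y ≈ 1#)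

  HasSize : ℕ → Set (c ⊔ ℓ)
  HasSize q = Σ (Fin q → Carrier) λ f →
    (∀ i j → f i ≈ f j → i ≡ j) × (∀ x → Σ (Fin q) λ i → f i ≈ x)

  -- Monomials in X_1..X_n: exponent vectors.  Polynomials: finite lists of
  -- terms (coefficient, monomial); two polynomials are equal in F[X_1..X_n]
  -- iff all their coefficients agree.
  Monomial : ℕ → Set
  Monomial n = Vec ℕ n

  Poly : ℕ → Set c
  Poly n = List (Carrier × Monomial n)

  coeff : ∀ {n} → Poly n → Monomial n → Carrier
  coeff [] e = 0#
  coeff ((a , m) ∷ P) e = if does (≡-dec ℕ._≟_ m e) then a + coeff P e else coeff P e

  _≋_ : ∀ {n} → Poly n → Poly n → Set ℓ
  P ≋ Q = ∀ e → coeff P e ≈ coeff Q e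

  var : ∀ {n} → Fin n → Monomial n
  var k = tabulate λ j → if does (j Fin.≟ k) then 1 else 0

  polyMul : ∀ {n} → Poly n → Poly n → Poly n
  polyMul P Q = concatMap (λ { (a , m) → map (λ { (b , m′) → (a * b , zipWith ℕ._+_ m m′) }) Q }) P

  polyOne : ∀ {n} → Poly n
  polyOne = (1# , replicate _ 0) ∷ []

  LinForm : ℕ → Set c
  LinForm n = Vec Carrier n

  linPoly : ∀ {n} → LinForm n → Poly n
  linPoly {n} a = map (λ k → (lookup a k , var k)) (allFin n)

  HomCircuit : ℕ → ℕ → Set c
  HomCircuit n g = Vec (List (LinForm n)) g

  gatePoly : ∀ {n} → List (LinForm n) → Poly n
  gatePoly Ls = foldr (λ L P → polyMul (linPoly L) P) polyOne Ls

  circuitPoly : ∀ {n g} → HomCircuit n g → Poly n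
  circuitPoly C = Vec.foldr _ (λ Ls P → gatePoly Ls ++ P) [] C

  S2 : (n : ℕ) → Poly n
  S2 n = concatMap (λ i → concatMap (λ j →
           if does (i <? j) then (1# , zipWith ℕ._+_ (var i) (var j)) ∷ [] else []) (allFin n)) (allFin n)

  S2ComputableWith : ℕ → ℕ → Set (c ⊔ ℓ)
  S2ComputableWith n g = Σ (HomCircuit n g) λ C → circuitPoly C ≋ S2 n

module Submission where

-- Over a field of characteristic p = 2k + 1 we have S_n^2 = h ((Σ x)² − Σ x²) with h = k + 1 = 1/2,
-- so it suffices to write (Σ x)² − Σ x² as a sum of ⌈n/2⌉ products of two linear forms.
-- Pigeonhole on the k + 1 squares and the k + 1 values −1 − b² modulo p gives A² + B² = −1 in F, and then
--   (A y₀ + B y₁ − y₂)(A y₀ + B y₁ + y₂) + (B y₀ − A y₁ − y₃)(B y₀ − A y₁ + y₃) = −(y₀² + y₁² + y₂² + y₃²),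
-- so together with (Σ y)² this writes (Σ y)² − Σ y² on 4t variables with 2t + 1 products (on 4t + 1
-- variables, using (Σ y′)(2 y₀ + Σ y′) instead). If the number m of variables y is 0 in F, substituting
-- yᵢ = xᵢ₊₁ − x₀ turns this into (Σ x)² − Σ x² on m + 1 variables; m = 4t and m = 4t + 1 can both be
-- made divisible by p, giving odd and even n. A finite field of size p^r has characteristic p, and since
-- 2 is invertible, polarization turns the identity of functions into an identity of polynomials.

open import Defs
open import Level using (Level; _⊔_)
open import Algebra.Bundles using (CommutativeRing)
open import Data.Nat using (ℕ)

-- Integer coefficients are interpreted through the TCOptimised ℕ-multiple, so that
-- the solver constants con 0 and con 1 are definitionally 0# and 1#.
module ℤ-Solver {c ℓ : Level} (F : CommutativeRing c ℓ) where
  open import Algebra.Solver.Ring.AlmostCommutativeRing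
    using (fromCommutativeRing; _-Raw-AlmostCommutative⟶_)
  open import Data.Maybe using (Maybe; just; nothing)
  open import Data.Nat as ℕ using (zero; suc)
  open import Data.Integer as ℤ using (ℤ; +_; -[1+_]; _⊖_)
  import Data.Integer.Properties as ℤ
  open import Data.Sign as Sign using (Sign)
  import Relation.Binary.PropositionalEquality as ≡
  open import Relation.Nullary using (yes; no)

  open CommutativeRing F
  open import Algebra.Properties.Ring ring using (-0#≈0#; -‿involutive; -‿+-comm; -1*x≈-x; -‿distribʳ-*)
  open import Algebra.Properties.Semiring.Mult.TCOptimised semiring using (_×_; 1+×; ×-homo-+; ×1-homo-*)
  open import Relation.Binary.Reasoning.Setoid setoid

  fromℤ : ℤ → Carrier
  fromℤ (+ n) = n × 1#
  fromℤ -[1+ n ] = - (suc n × 1#)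

  fromSign : Sign → Carrier
  fromSign Sign.+ = 1#
  fromSign Sign.- = - 1#

  fromℤ-⊖ : ∀ m n → fromℤ (m ⊖ n) ≈ m × 1# - n × 1#
  fromℤ-⊖ m zero = begin
    fromℤ (m ⊖ 0) ≡⟨ ≡.cong fromℤ (ℤ.⊖-≥ {m} {0} ℕ.z≤n) ⟩
    m × 1#        ≈⟨ sym (+-identityʳ _) ⟩
    m × 1# + 0#   ≈⟨ +-congˡ (sym -0#≈0#) ⟩
    m × 1# - 0#   ∎
  fromℤ-⊖ zero (suc n) = sym (+-identityˡ _)
  fromℤ-⊖ (suc m) (suc n) = begin
    fromℤ (suc m ⊖ suc n)           ≡⟨ ≡.cong fromℤ (ℤ.[1+m]⊖[1+n]≡m⊖n m n) ⟩
    fromℤ (m ⊖ n)                   ≈⟨ fromℤ-⊖ m n ⟩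
    m × 1# - n × 1#                 ≈⟨ +-congˡ (sym (+-identityˡ _)) ⟩
    m × 1# + (0# - n × 1#)          ≈⟨ +-congˡ (+-congʳ (sym (-‿inverseʳ 1#))) ⟩
    m × 1# + ((1# - 1#) - n × 1#)   ≈⟨ +-congˡ (+-assoc _ _ _) ⟩
    m × 1# + (1# + (- 1# - n × 1#)) ≈⟨ sym (+-assoc _ _ _) ⟩
    (m × 1# + 1#) + (- 1# - n × 1#) ≈⟨ +-cong (trans (+-comm _ _) (sym (1+× m 1#)))
                                              (trans (-‿+-comm _ _) (-‿cong (sym (1+× n 1#)))) ⟩
    suc m × 1# - suc n × 1#         ∎

  fromℤ-+ : ∀ i j → fromℤ (i ℤ.+ j) ≈ fromℤ i + fromℤ j
  fromℤ-+ -[1+ m ] -[1+ n ] = begin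
    - (suc (suc (m ℕ.+ n)) × 1#)        ≈⟨ -‿cong (trans (1+× (suc (m ℕ.+ n)) 1#) (+-congˡ (×-homo-+ 1# (suc m) n))) ⟩
    - (1# + (suc m × 1# + n × 1#))      ≈⟨ -‿cong (sym (+-assoc _ _ _)) ⟩
    - ((1# + suc m × 1#) + n × 1#)      ≈⟨ -‿cong (+-congʳ (+-comm _ _)) ⟩
    - ((suc m × 1# + 1#) + n × 1#)      ≈⟨ -‿cong (trans (+-assoc _ _ _) (+-congˡ (sym (1+× n 1#)))) ⟩
    - (suc m × 1# + suc n × 1#)         ≈⟨ sym (-‿+-comm _ _) ⟩
    - (suc m × 1#) + - (suc n × 1#)     ∎
  fromℤ-+ -[1+ m ] (+ n) = trans (fromℤ-⊖ n (suc m)) (+-comm _ _)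
  fromℤ-+ (+ m) -[1+ n ] = fromℤ-⊖ m (suc n)
  fromℤ-+ (+ m) (+ n) = ×-homo-+ 1# m n

  fromℤ-neg : ∀ i → fromℤ (ℤ.- i) ≈ - fromℤ i
  fromℤ-neg (+ zero) = sym -0#≈0#
  fromℤ-neg (+ suc n) = refl
  fromℤ-neg -[1+ n ] = sym (-‿involutive _)

  fromℤ-◃ : ∀ s n → fromℤ (s ℤ.◃ n) ≈ fromSign s * n × 1#
  fromℤ-◃ s zero = sym (zeroʳ _)
  fromℤ-◃ Sign.+ (suc n) = sym (*-identityˡ _)
  fromℤ-◃ Sign.- (suc n) = sym (-1*x≈-x _)

  fromℤ-sign-abs : ∀ i → fromℤ i ≈ fromSign (ℤ.sign i) * ℤ.∣ i ∣ × 1#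
  fromℤ-sign-abs i = begin
    fromℤ i                                  ≡⟨ ≡.cong fromℤ (≡.sym (ℤ.◃-inverse i)) ⟩
    fromℤ (ℤ.sign i ℤ.◃ ℤ.∣ i ∣)             ≈⟨ fromℤ-◃ (ℤ.sign i) ℤ.∣ i ∣ ⟩
    fromSign (ℤ.sign i) * ℤ.∣ i ∣ × 1#       ∎

  fromSign-* : ∀ s t → fromSign (s Sign.* t) ≈ fromSign s * fromSign t
  fromSign-* Sign.+ t = sym (*-identityˡ _)
  fromSign-* Sign.- Sign.+ = sym (*-identityʳ _)
  fromSign-* Sign.- Sign.- = begin
    1#             ≈⟨ sym (-‿involutive _) ⟩
    - - 1#         ≈⟨ -‿cong (sym (-1*x≈-x 1#)) ⟩
    - (- 1# * 1#)  ≈⟨ -‿distribʳ-* _ _ ⟩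
    - 1# * - 1#    ∎

  fromℤ-* : ∀ i j → fromℤ (i ℤ.* j) ≈ fromℤ i * fromℤ j
  fromℤ-* i j = begin
    fromℤ (i ℤ.* j)                       ≈⟨ fromℤ-◃ (s Sign.* t) (a ℕ.* b) ⟩
    fromSign (s Sign.* t) * (a ℕ.* b) × 1# ≈⟨ *-cong (fromSign-* s t) (×1-homo-* a b) ⟩
    (σs * σt) * (α * β)                   ≈⟨ interchange σs σt α β ⟩
    (σs * α) * (σt * β)                   ≈⟨ sym (*-cong (fromℤ-sign-abs i) (fromℤ-sign-abs j)) ⟩
    fromℤ i * fromℤ j                     ∎
    where
    s t : Sign
    s = ℤ.sign i
    t = ℤ.sign j
    a b : ℕ
    a = ℤ.∣ i ∣
    b = ℤ.∣ j ∣
    σs σt α β : Carrier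
    σs = fromSign s
    σt = fromSign t
    α = a × 1#
    β = b × 1#
    interchange : ∀ w x y z → (w * x) * (y * z) ≈ (w * y) * (x * z)
    interchange w x y z = begin
      (w * x) * (y * z) ≈⟨ *-assoc _ _ _ ⟩
      w * (x * (y * z)) ≈⟨ *-congˡ (sym (*-assoc _ _ _)) ⟩
      w * ((x * y) * z) ≈⟨ *-congˡ (*-congʳ (*-comm _ _)) ⟩
      w * ((y * x) * z) ≈⟨ *-congˡ (*-assoc _ _ _) ⟩
      w * (y * (x * z)) ≈⟨ sym (*-assoc _ _ _) ⟩
      (w * y) * (x * z) ∎

  fromℤ-homomorphism : ℤ.+-*-rawRing -Raw-AlmostCommutative⟶ fromCommutativeRing F
  fromℤ-homomorphism = record
    { ⟦_⟧ = fromℤ ; +-homo = fromℤ-+ ; *-homo = fromℤ-* ; -‿homo = fromℤ-neg ; 0-homo = refl ; 1-homo = refl }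

  fromℤ-≈? : ∀ i j → Maybe (fromℤ i ≈ fromℤ j)
  fromℤ-≈? i j with i ℤ.≟ j
  ... | yes ≡.refl = just refl
  ... | no _ = nothing

  open import Algebra.Solver.Ring ℤ.+-*-rawRing (fromCommutativeRing F) fromℤ-homomorphism fromℤ-≈? public

module SquaresModOddPrime (k : ℕ) where
  open import Data.Nat
  open import Data.Nat.Properties
  open import Data.Nat.DivMod using (m≡m%n+[m/n]*n; m%n<n)
  open import Data.Nat.Divisibility using (_∣_; divides; >⇒∤)
  open import Data.Nat.Primality using (Prime; euclidsLemma)
  open import Data.Fin as Fin using (Fin; toℕ; fromℕ<; splitAt; join)
  import Data.Fin.Properties as Fin
  open import Data.Sum using (_⊎_; inj₁; inj₂; [_,_]′)
  open import Data.Product using (_,_; ∃₂)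
  open import Data.Empty using (⊥; ⊥-elim)
  open import Relation.Binary.PropositionalEquality
  open import Relation.Binary.Definitions using (tri<; tri≈; tri>)
  open import Data.Nat.Solver using (module +-*-Solver)
  open +-*-Solver using (solve; _:=_; _:+_; _:*_; con)

  P : ℕ
  P = 1 + k * 2

  ∣-of-%-≡ : ∀ m n → (m + n) % P ≡ m % P → P ∣ n
  ∣-of-%-≡ m n eq = divides (q′ ∸ q) (begin
      n                  ≡⟨ m+n∸m≡n (q * P) n ⟨
      q * P + n ∸ q * P  ≡⟨ cong (_∸ q * P) qP+n≡q′P ⟩
      q′ * P ∸ q * P     ≡⟨ *-distribʳ-∸ P q′ q ⟨
      (q′ ∸ q) * P       ∎)
    where
    open ≡-Reasoning
    q q′ : ℕ
    q = m / P
    q′ = (m + n) / P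
    qP+n≡q′P : q * P + n ≡ q′ * P
    qP+n≡q′P = +-cancelˡ-≡ (m % P) _ _ (begin
      m % P + (q * P + n) ≡⟨ +-assoc (m % P) (q * P) n ⟨
      m % P + q * P + n   ≡⟨ cong (_+ n) (m≡m%n+[m/n]*n m P) ⟨
      m + n               ≡⟨ m≡m%n+[m/n]*n (m + n) P ⟩
      (m + n) % P + q′ * P ≡⟨ cong (_+ q′ * P) eq ⟩
      m % P + q′ * P      ∎)

  ∤-between : ∀ {n} → 0 < n → n < P → P ∣ n → ⊥
  ∤-between {suc _} _ n<P = >⇒∤ n<P

  -- y² − x² = (y − x)(y + x), and both factors lie strictly between 0 and P.
  square-%-injective : Prime P → ∀ {x y} → x < y → y ≤ k → y * y % P ≡ x * x % P → ⊥
  square-%-injective P-prime {x} {y} x<y y≤k eq =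
    [ ∤-between (m<n⇒0<n∸m x<y) d<P , ∤-between (<-≤-trans (≤-<-trans z≤n x<y) (m≤n+m y x)) x+y<P ]′
      (euclidsLemma d (x + y) P-prime (∣-of-%-≡ (x * x) (d * (x + y)) sq-eq))
    where
    d : ℕ
    d = y ∸ x
    y≡x+d : y ≡ x + d
    y≡x+d = sym (m+[n∸m]≡n (<⇒≤ x<y))
    expand : ∀ x d → (x + d) * (x + d) ≡ x * x + d * (x + (x + d))
    expand = solve 2 (λ x d → (x :+ d) :* (x :+ d) := x :* x :+ d :* (x :+ (x :+ d))) refl
    sq-eq : (x * x + d * (x + y)) % P ≡ x * x % P
    sq-eq = begin
      (x * x + d * (x + y)) % P       ≡⟨ cong (λ z → (x * x + d * (x + z)) % P) y≡x+d ⟩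
      (x * x + d * (x + (x + d))) % P ≡⟨ cong (_% P) (expand x d) ⟨
      (x + d) * (x + d) % P           ≡⟨ cong (λ z → z * z % P) y≡x+d ⟨
      y * y % P                       ≡⟨ eq ⟩
      x * x % P                       ∎
      where open ≡-Reasoning
    d<P : d < P
    d<P = ≤-<-trans (m∸n≤m y x) (≤-<-trans y≤k (s≤s (m≤m*n k 2)))
    x+y<P : x + y < P
    x+y<P = begin-strict
      x + y  <⟨ +-monoˡ-< y x<y ⟩
      y + y  ≤⟨ +-mono-≤ y≤k y≤k ⟩
      k + k  ≡⟨ solve 1 (λ k → k :+ k := k :* con 2) refl k ⟩
      k * 2  <⟨ n<1+n _ ⟩
      P      ∎
      where open ≤-Reasoning

  square% : Fin (suc k) → ℕ
  square% a = toℕ a * toℕ a % P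

  square%<P : ∀ a → square% a < P
  square%<P a = m%n<n (toℕ a * toℕ a) P

  square%-injective : Prime P → ∀ a b → square% a ≡ square% b → a ≡ b
  square%-injective P-prime a b eq with Fin.<-cmp a b
  ... | tri< a<b _ _ = ⊥-elim (square-%-injective P-prime a<b (Fin.toℕ≤pred[n] b) (sym eq))
  ... | tri≈ _ a≡b _ = a≡b
  ... | tri> _ _ b<a = ⊥-elim (square-%-injective P-prime b<a (Fin.toℕ≤pred[n] a) eq)

  -- the residue of −1 − r
  complement : ℕ → ℕ
  complement r = P ∸ suc r

  complement-injective : ∀ {r s} → r < P → s < P → complement r ≡ complement s → r ≡ s
  complement-injective {r} {s} r<P s<P eq = suc-injective (+-cancelˡ-≡ (complement s) _ _ (begin
    complement s + suc r ≡⟨ cong (_+ suc r) eq ⟨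
    complement r + suc r ≡⟨ m∸n+n≡m r<P ⟩
    P                    ≡⟨ m∸n+n≡m s<P ⟨
    complement s + suc s ∎))
    where open ≡-Reasoning

  ∣-sum-of-two-squares+1 : ∀ x y → x * x % P ≡ complement (y * y % P) → P ∣ x * x + y * y + 1
  ∣-sum-of-two-squares+1 x y eq = divides (suc (qx + qy)) (begin
      x * x + y * y + 1                 ≡⟨ cong₂ (λ u v → u + v + 1) (m≡m%n+[m/n]*n (x * x) P) (m≡m%n+[m/n]*n (y * y) P) ⟩
      (rx + qx * P) + (ry + qy * P) + 1 ≡⟨ solve 5 (λ rx qx ry qy P → (rx :+ qx :* P) :+ (ry :+ qy :* P) :+ con 1
                                                                := (rx :+ (con 1 :+ ry)) :+ (qx :+ qy) :* P) refl rx qx ry qy P ⟩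
      (rx + suc ry) + (qx + qy) * P     ≡⟨ cong (_+ (qx + qy) * P) (trans (cong (_+ suc ry) eq) (m∸n+n≡m (m%n<n (y * y) P))) ⟩
      P + (qx + qy) * P                 ∎)
    where
    open ≡-Reasoning
    rx ry qx qy : ℕ
    rx = x * x % P
    ry = y * y % P
    qx = x * x / P
    qy = y * y / P

  residue : Fin (suc k) ⊎ Fin (suc k) → ℕ
  residue (inj₁ a) = square% a
  residue (inj₂ b) = complement (square% b)

  residue<P : ∀ s → residue s < P
  residue<P (inj₁ a) = square%<P a
  residue<P (inj₂ b) = s≤s (m∸n≤m (k * 2) (square% b))

  collision⇒∣-sum-of-two-squares+1 : Prime P → ∀ s t → s ≢ t → residue s ≡ residue t →
    ∃₂ λ a b → P ∣ a * a + b * b + 1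
  collision⇒∣-sum-of-two-squares+1 P-prime (inj₁ a) (inj₁ a′) s≢t eq =
    ⊥-elim (s≢t (cong inj₁ (square%-injective P-prime a a′ eq)))
  collision⇒∣-sum-of-two-squares+1 P-prime (inj₂ b) (inj₂ b′) s≢t eq =
    ⊥-elim (s≢t (cong inj₂ (square%-injective P-prime b b′ (complement-injective (square%<P b) (square%<P b′) eq))))
  collision⇒∣-sum-of-two-squares+1 _ (inj₁ a) (inj₂ b) _ eq = toℕ a , toℕ b , ∣-sum-of-two-squares+1 (toℕ a) (toℕ b) eq
  collision⇒∣-sum-of-two-squares+1 _ (inj₂ b) (inj₁ a) _ eq = toℕ a , toℕ b , ∣-sum-of-two-squares+1 (toℕ a) (toℕ b) (sym eq)

  -- The k + 1 squares and the k + 1 values −1 − b² are 2k + 2 > P residues, so two coincide.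
  ∃-∣-sum-of-two-squares+1 : Prime P → ∃₂ λ a b → P ∣ a * a + b * b + 1
  ∃-∣-sum-of-two-squares+1 P-prime with Fin.pigeonhole P<2k+2 (λ i → fromℕ< (residue<P (splitAt (suc k) i)))
    where
    P<2k+2 : P < suc k + suc k
    P<2k+2 = s≤s (≤-reflexive (solve 1 (λ k → con 1 :+ k :* con 2 := k :+ (con 1 :+ k)) refl k))
  ... | i , j , i<j , eq = collision⇒∣-sum-of-two-squares+1 P-prime (splitAt (suc k) i) (splitAt (suc k) j) s≢t r≡r
    where
    s≢t : splitAt (suc k) i ≢ splitAt (suc k) j
    s≢t e = Fin.<⇒≢ i<j (trans (sym (Fin.join-splitAt (suc k) (suc k) i))
                        (trans (cong (join (suc k) (suc k)) e) (Fin.join-splitAt (suc k) (suc k) j)))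
    r≡r : residue (splitAt (suc k) i) ≡ residue (splitAt (suc k) j)
    r≡r = trans (sym (Fin.toℕ-fromℕ< _)) (trans (cong toℕ eq) (Fin.toℕ-fromℕ< _))

module FiniteField {c ℓ : Level} (F : CommutativeRing c ℓ) where
  open import Data.Nat as ℕ using (zero; suc)
  open import Data.Fin using (Fin)
  import Data.Fin.Properties as Fin
  open import Data.Fin.Permutation using (Permutation; permutation)
  open import Data.Product using (Σ; _,_; proj₁; proj₂)
  open import Data.Empty using (⊥-elim)
  open import Relation.Nullary using (Dec; yes; no)
  import Relation.Binary.PropositionalEquality as ≡

  open CommutativeRing F
  open import Algebra.Properties.Ring ring using (+-identityʳ-unique)
  open import Algebra.Properties.Semiring.Mult semiring using (_×_; ×1-homo-*)
  open import Algebra.Properties.Semiring.Exp semiring using (_^_)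
  open import Algebra.Properties.Semiring.Sum semiring using (sum; sum-cong-≋; sum-replicate; ∑-distrib-+; sum-permute)
  open import Relation.Binary.Reasoning.Setoid setoid

  ≈-dec : ∀ {N} → HasSize F N → ∀ x y → Dec (x ≈ y)
  ≈-dec (f , f-injective , f-surjective) x y with f-surjective x | f-surjective y
  ... | i , fi≈x | j , fj≈y with i Fin.≟ j
  ... | yes ≡.refl = yes (trans (sym fi≈x) fj≈y)
  ... | no i≢j = no (λ x≈y → i≢j (f-injective i j (trans fi≈x (trans x≈y (sym fj≈y)))))

  module _ {N} (f : Fin N → Carrier) (f-injective : ∀ i j → f i ≈ f j → i ≡.≡ j)
           (f-surjective : ∀ x → Σ (Fin N) λ i → f i ≈ x) where

    translate : Carrier → Fin N → Fin N
    translate a i = proj₁ (f-surjective (f i + a))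

    translate-cancel : ∀ a b → b + a ≈ 0# → ∀ i → translate a (translate b i) ≡.≡ i
    translate-cancel a b b+a≈0 i = f-injective _ _ (begin
      f (translate a (translate b i)) ≈⟨ proj₂ (f-surjective _) ⟩
      f (translate b i) + a           ≈⟨ +-congʳ (proj₂ (f-surjective _)) ⟩
      (f i + b) + a                   ≈⟨ +-assoc _ _ _ ⟩
      f i + (b + a)                   ≈⟨ +-congˡ b+a≈0 ⟩
      f i + 0#                        ≈⟨ +-identityʳ _ ⟩
      f i                             ∎)

    translation : Carrier → Permutation N N
    translation a = permutation (translate a) (translate (- a))
      (translate-cancel a (- a) (-‿inverseˡ a)) (translate-cancel (- a) a (-‿inverseʳ a))

    -- Translating by 1 permutes the elements, so their sum s satisfies s + N·1 = s.
    size×1≈0 : N × 1# ≈ 0#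
    size×1≈0 = +-identityʳ-unique (sum f) (N × 1#) (sym (begin
      sum f                      ≈⟨ sum-permute f (translation 1#) ⟩
      sum (λ i → f (translate 1# i)) ≈⟨ sum-cong-≋ (λ i → proj₂ (f-surjective (f i + 1#))) ⟩
      sum (λ i → f i + 1#)       ≈⟨ ∑-distrib-+ f (λ _ → 1#) ⟩
      sum f + sum {N} (λ _ → 1#) ≈⟨ +-congˡ (sum-replicate N) ⟩
      sum f + N × 1#             ∎))

  ×1-homo-^ : ∀ m n → (m ℕ.^ n) × 1# ≈ (m × 1#) ^ n
  ×1-homo-^ m zero = +-identityʳ 1#
  ×1-homo-^ m (suc n) = trans (×1-homo-* m (m ℕ.^ n)) (*-congˡ (×1-homo-^ m n))

  module _ (isField : IsField F) (_≈?_ : ∀ x y → Dec (x ≈ y)) where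

    x^[1+n]≈0⇒x≈0 : ∀ x n → x ^ suc n ≈ 0# → x ≈ 0#
    x^[1+n]≈0⇒x≈0 x n xⁿ≈0 with x ≈? 0#
    ... | yes x≈0 = x≈0
    ... | no x≉0 = ⊥-elim (proj₁ isField (0≈1 n xⁿ≈0))
      where
      y : Carrier
      y = proj₁ (proj₂ isField x x≉0)
      xy≈1 : x * y ≈ 1#
      xy≈1 = proj₂ (proj₂ isField x x≉0)
      0≈1 : ∀ n → x ^ suc n ≈ 0# → 0# ≈ 1#
      0≈1 zero x≈0 = begin
        0#           ≈⟨ zeroˡ y ⟨
        0# * y       ≈⟨ *-congʳ x≈0 ⟨
        (x * 1#) * y ≈⟨ *-congʳ (*-identityʳ x) ⟩
        x * y        ≈⟨ xy≈1 ⟩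
        1#           ∎
      0≈1 (suc n) xⁿ⁺²≈0 = 0≈1 n (begin
        x ^ suc n             ≈⟨ *-identityˡ _ ⟨
        1# * x ^ suc n        ≈⟨ *-congʳ xy≈1 ⟨
        (x * y) * x ^ suc n   ≈⟨ *-congʳ (*-comm x y) ⟩
        (y * x) * x ^ suc n   ≈⟨ *-assoc y x _ ⟩
        y * x ^ suc (suc n)   ≈⟨ *-congˡ xⁿ⁺²≈0 ⟩
        y * 0#                ≈⟨ zeroʳ y ⟩
        0#                    ∎)

  characteristic : IsField F → ∀ p r → HasSize F (p ℕ.^ suc r) → p × 1# ≈ 0#
  characteristic isField p r size@(f , f-injective , f-surjective) = x^[1+n]≈0⇒x≈0 isField (≈-dec size) (p × 1#) r
    (trans (sym (×1-homo-^ p (suc r))) (size×1≈0 f f-injective f-surjective))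

module QuadraticCircuits {c ℓ : Level} (F : CommutativeRing c ℓ) where
  open import Data.Nat as ℕ using (zero; suc)
  import Data.Nat.Properties as ℕ
  open import Data.Fin as Fin using (Fin; zero; suc)
  open import Data.List as List using (List; []; _∷_; _++_; concatMap; allFin)
  open import Data.Vec as Vec using (lookup; zipWith; replicate; tabulate)
  import Data.Vec.Properties as Vec
  open import Data.Product using (_×_; _,_; proj₁; proj₂)
  open import Data.Bool using (true; false; if_then_else_)
  open import Relation.Nullary using (does)
  import Relation.Binary.PropositionalEquality as ≡

  open CommutativeRing F hiding (zero)
  open import Algebra.Properties.Semiring.Sum semiring
    using (sum; sum-cong-≋; sum-replicate-zero; ∑-distrib-+; ∑-comm)
  open import Relation.Binary.Reasoning.Setoid setoid

  Gate : ℕ → Set c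
  Gate n = LinForm F n × LinForm F n

  circuit : ∀ {n g} → (Fin g → Gate n) → HomCircuit F n g
  circuit G = tabulate (λ t → proj₁ (G t) ∷ proj₂ (G t) ∷ [])

  ∑ₗ : ∀ {a} {A : Set a} → List A → (A → Carrier) → Carrier
  ∑ₗ [] f = 0#
  ∑ₗ (x ∷ xs) f = f x + ∑ₗ xs f

  ∑ₗ-++ : ∀ {a} {A : Set a} (xs ys : List A) f → ∑ₗ (xs ++ ys) f ≈ ∑ₗ xs f + ∑ₗ ys f
  ∑ₗ-++ [] ys f = sym (+-identityˡ _)
  ∑ₗ-++ (x ∷ xs) ys f = trans (+-congˡ (∑ₗ-++ xs ys f)) (sym (+-assoc _ _ _))

  ∑ₗ-map : ∀ {a b} {A : Set a} {B : Set b} (g : A → B) (xs : List A) f →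
    ∑ₗ (List.map g xs) f ≈ ∑ₗ xs (λ x → f (g x))
  ∑ₗ-map g [] f = refl
  ∑ₗ-map g (x ∷ xs) f = +-congˡ (∑ₗ-map g xs f)

  ∑ₗ-concatMap : ∀ {a b} {A : Set a} {B : Set b} (g : A → List B) (xs : List A) f →
    ∑ₗ (concatMap g xs) f ≈ ∑ₗ xs (λ x → ∑ₗ (g x) f)
  ∑ₗ-concatMap g [] f = refl
  ∑ₗ-concatMap g (x ∷ xs) f = trans (∑ₗ-++ (g x) (concatMap g xs) f) (+-congˡ (∑ₗ-concatMap g xs f))

  ∑ₗ-tabulate : ∀ {a} {A : Set a} n (g : Fin n → A) f → ∑ₗ (List.tabulate g) f ≈ sum (λ i → f (g i))
  ∑ₗ-tabulate zero g f = refl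
  ∑ₗ-tabulate (suc n) g f = +-congˡ (∑ₗ-tabulate n (λ i → g (suc i)) f)

  module _ {n : ℕ} where

    indicator : Monomial F n → Monomial F n → Carrier
    indicator m e = if does (Vec.≡-dec ℕ._≟_ m e) then 1# else 0#

    term : Monomial F n → Carrier × Monomial F n → Carrier
    term e (a , m) = a * indicator m e

    coeff≈∑ₗ : ∀ (P : Poly F n) e → coeff F P e ≈ ∑ₗ P (term e)
    coeff≈∑ₗ [] e = refl
    coeff≈∑ₗ ((a , m) ∷ P) e with does (Vec.≡-dec ℕ._≟_ m e)
    ... | true = +-cong (sym (*-identityʳ a)) (coeff≈∑ₗ P e)
    ... | false = trans (sym (+-identityˡ _)) (+-cong (sym (zeroʳ a)) (coeff≈∑ₗ P e))

    coeff-++ : ∀ (P Q : Poly F n) e → coeff F (P ++ Q) e ≈ coeff F P e + coeff F Q e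
    coeff-++ P Q e = begin
      coeff F (P ++ Q) e              ≈⟨ coeff≈∑ₗ (P ++ Q) e ⟩
      ∑ₗ (P ++ Q) (term e)            ≈⟨ ∑ₗ-++ P Q (term e) ⟩
      ∑ₗ P (term e) + ∑ₗ Q (term e)   ≈⟨ sym (+-cong (coeff≈∑ₗ P e) (coeff≈∑ₗ Q e)) ⟩
      coeff F P e + coeff F Q e       ∎

    ∑ₗ-polyMul : ∀ (P Q : Poly F n) f → ∑ₗ (polyMul F P Q) f ≈
      ∑ₗ P (λ (a , m) → ∑ₗ Q (λ (b , m′) → f (a * b , zipWith ℕ._+_ m m′)))
    ∑ₗ-polyMul [] Q f = refl
    ∑ₗ-polyMul ((a , m) ∷ P) Q f = trans (∑ₗ-++ (List.map mul Q) (polyMul F P Q) f)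
      (+-cong (∑ₗ-map mul Q f) (∑ₗ-polyMul P Q f))
      where
      mul : Carrier × Monomial F n → Carrier × Monomial F n
      mul (b , m′) = a * b , zipWith ℕ._+_ m m′

    varProduct : Fin n → Fin n → Monomial F n
    varProduct k l = zipWith ℕ._+_ (var F k) (var F l)

    varProduct-comm : ∀ k l → varProduct k l ≡.≡ varProduct l k
    varProduct-comm k l = Vec.zipWith-comm ℕ.+-comm (var F k) (var F l)

    quadCoeff : (Fin n → Fin n → Carrier) → Monomial F n → Carrier
    quadCoeff C e = sum (λ k → sum (λ l → C k l * indicator (varProduct k l) e))

    outer : Gate n → Fin n → Fin n → Carrier
    outer (L , M) k l = lookup L k * lookup M l

    ∑ₗ-linPoly : ∀ L f → ∑ₗ (linPoly F L) f ≈ sum (λ k → f (lookup L k , var F k))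
    ∑ₗ-linPoly L f = trans (∑ₗ-map (λ k → lookup L k , var F k) (allFin n) f)
      (∑ₗ-tabulate n (λ k → k) (λ k → f (lookup L k , var F k)))

    coeff-gate : ∀ G e → coeff F (gatePoly F (proj₁ G ∷ proj₂ G ∷ [])) e ≈ quadCoeff (outer G) e
    coeff-gate (L , M) e = begin
      coeff F (gatePoly F (L ∷ M ∷ [])) e
        ≈⟨ coeff≈∑ₗ (polyMul F (linPoly F L) Q) e ⟩
      ∑ₗ (polyMul F (linPoly F L) Q) (term e)
        ≈⟨ ∑ₗ-polyMul (linPoly F L) Q (term e) ⟩
      ∑ₗ (linPoly F L) (λ t → ∑ₗ Q (λ u → term e (proj₁ t * proj₁ u , zipWith ℕ._+_ (proj₂ t) (proj₂ u))))
        ≈⟨ ∑ₗ-linPoly L _ ⟩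
      sum (λ k → ∑ₗ Q (λ u → term e (lookup L k * proj₁ u , zipWith ℕ._+_ (var F k) (proj₂ u))))
        ≈⟨ sum-cong-≋ {n} (λ k → trans (∑ₗ-polyMul (linPoly F M) (polyOne F) _) (∑ₗ-linPoly M _)) ⟩
      sum (λ k → sum (λ l → term e (lookup L k * (lookup M l * 1#) , zipWith ℕ._+_ (var F k) (zipWith ℕ._+_ (var F l) (replicate n 0))) + 0#))
        ≈⟨ sum-cong-≋ {n} (λ k → sum-cong-≋ {n} (λ l → trans (+-identityʳ _) (*-cong (*-congˡ (*-identityʳ _)) (reflexive (
             ≡.cong (λ m → indicator (zipWith ℕ._+_ (var F k) m) e) (Vec.zipWith-identityʳ ℕ.+-identityʳ (var F l))))))) ⟩
      quadCoeff (outer (L , M)) e ∎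
      where
      Q : Poly F n
      Q = polyMul F (linPoly F M) (polyOne F)

    coeff-circuit : ∀ {g} (G : Fin g → Gate n) e →
      coeff F (circuitPoly F (circuit G)) e ≈ sum (λ t → quadCoeff (outer (G t)) e)
    coeff-circuit {zero} G e = refl
    coeff-circuit {suc g} G e =
      trans (coeff-++ (gatePoly F (proj₁ (G zero) ∷ proj₂ (G zero) ∷ [])) (circuitPoly F (circuit (λ t → G (suc t)))) e) (+-cong (coeff-gate (G zero) e) (coeff-circuit (λ t → G (suc t)) e))

    [_<_] : Fin n → Fin n → Carrier
    [ k < l ] = if does (k Fin.<? l) then 1# else 0#

    coeff-S2 : ∀ e → coeff F (S2 F n) e ≈ quadCoeff [_<_] e
    coeff-S2 e = begin
      coeff F (S2 F n) e                                      ≈⟨ coeff≈∑ₗ (S2 F n) e ⟩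
      ∑ₗ (S2 F n) (term e)                                    ≈⟨ ∑ₗ-concatMap row (allFin n) (term e) ⟩
      ∑ₗ (allFin n) (λ k → ∑ₗ (row k) (term e))               ≈⟨ ∑ₗ-tabulate n (λ k → k) (λ k → ∑ₗ (row k) (term e)) ⟩
      sum (λ k → ∑ₗ (row k) (term e))                         ≈⟨ sum-cong-≋ {n} (λ k → ∑ₗ-concatMap (entry k) (allFin n) (term e)) ⟩
      sum (λ k → ∑ₗ (allFin n) (λ l → ∑ₗ (entry k l) (term e))) ≈⟨ sum-cong-≋ {n} (λ k → ∑ₗ-tabulate n (λ l → l) (λ l → ∑ₗ (entry k l) (term e))) ⟩
      sum (λ k → sum (λ l → ∑ₗ (entry k l) (term e)))         ≈⟨ sum-cong-≋ {n} (λ k → sum-cong-≋ (entry-term k)) ⟩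
      quadCoeff [_<_] e                                       ∎
      where
      entry : Fin n → Fin n → Poly F n
      entry k l = if does (k Fin.<? l) then (1# , varProduct k l) ∷ [] else []
      row : Fin n → Poly F n
      row k = concatMap (entry k) (allFin n)
      entry-term : ∀ k l → ∑ₗ (entry k l) (term e) ≈ [ k < l ] * indicator (varProduct k l) e
      entry-term k l with does (k Fin.<? l)
      ... | true = +-identityʳ _
      ... | false = sym (zeroˡ _)

    quadCoeff-cong : ∀ {C D} e → (∀ k l → C k l ≈ D k l) → quadCoeff C e ≈ quadCoeff D e
    quadCoeff-cong e C≈D = sum-cong-≋ {n} (λ k → sum-cong-≋ {n} (λ l → *-congʳ (C≈D k l)))

    quadCoeff-+ : ∀ C D e → quadCoeff C e + quadCoeff D e ≈ quadCoeff (λ k l → C k l + D k l) e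
    quadCoeff-+ C D e = begin
      quadCoeff C e + quadCoeff D e
        ≈⟨ ∑-distrib-+ {n} (λ k → sum (λ l → C k l * δ k l)) (λ k → sum (λ l → D k l * δ k l)) ⟨
      sum (λ k → sum (λ l → C k l * δ k l) + sum (λ l → D k l * δ k l))
        ≈⟨ sum-cong-≋ {n} (λ k → ∑-distrib-+ {n} (λ l → C k l * δ k l) (λ l → D k l * δ k l)) ⟨
      sum (λ k → sum (λ l → C k l * δ k l + D k l * δ k l))
        ≈⟨ sum-cong-≋ {n} (λ k → sum-cong-≋ {n} (λ l → distribʳ (δ k l) (C k l) (D k l))) ⟨
      quadCoeff (λ k l → C k l + D k l) e ∎
      where
      δ : Fin n → Fin n → Carrier
      δ k l = indicator (varProduct k l) e

    quadCoeff-0 : ∀ e → quadCoeff (λ _ _ → 0#) e ≈ 0#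
    quadCoeff-0 e = trans (sum-cong-≋ {n} (λ k → trans (sum-cong-≋ {n} (λ l → zeroˡ _)) (sum-replicate-zero n)))
      (sum-replicate-zero n)

    quadCoeff-sum : ∀ {g} (C : Fin g → Fin n → Fin n → Carrier) e →
      sum (λ t → quadCoeff (C t) e) ≈ quadCoeff (λ k l → sum (λ t → C t k l)) e
    quadCoeff-sum {zero} C e = sym (quadCoeff-0 e)
    quadCoeff-sum {suc g} C e =
      trans (+-congˡ (quadCoeff-sum (λ t → C (suc t)) e)) (quadCoeff-+ (C zero) _ e)

    quadCoeff-transpose : ∀ C e → quadCoeff (λ k l → C l k) e ≈ quadCoeff C e
    quadCoeff-transpose C e = trans (∑-comm {n} {n} (λ k l → C l k * indicator (varProduct k l) e))
      (sum-cong-≋ {n} (λ l → sum-cong-≋ {n} (λ k →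
        *-congˡ (reflexive (≡.cong (λ m → indicator m e) (varProduct-comm k l))))))

    symmetrize : (Fin n → Fin n → Carrier) → Fin n → Fin n → Carrier
    symmetrize C k l = C k l + C l k

    quadCoeff-symmetrize : ∀ C e → quadCoeff (symmetrize C) e ≈ quadCoeff C e + quadCoeff C e
    quadCoeff-symmetrize C e =
      trans (sym (quadCoeff-+ C (λ k l → C l k) e)) (+-congˡ (quadCoeff-transpose C e))

  module _ {h : Carrier} (h+h≈1 : h * (1# + 1#) ≈ 1#) where

    x+x≈y+y⇒x≈y : ∀ {x y} → x + x ≈ y + y → x ≈ y
    x+x≈y+y⇒x≈y {x} {y} x+x≈y+y = begin
      x                  ≈⟨ halve x ⟨
      h * (x + x)        ≈⟨ *-congˡ x+x≈y+y ⟩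
      h * (y + y)        ≈⟨ halve y ⟩
      y                  ∎
      where
      halve : ∀ z → h * (z + z) ≈ z
      halve z = begin
        h * (z + z)             ≈⟨ *-congˡ (+-cong (*-identityʳ z) (*-identityʳ z)) ⟨
        h * (z * 1# + z * 1#)   ≈⟨ *-congˡ (distribˡ z 1# 1#) ⟨
        h * (z * (1# + 1#))     ≈⟨ *-congˡ (*-comm z _) ⟩
        h * ((1# + 1#) * z)     ≈⟨ *-assoc h _ z ⟨
        (h * (1# + 1#)) * z     ≈⟨ *-congʳ h+h≈1 ⟩
        1# * z                  ≈⟨ *-identityˡ z ⟩
        z                       ∎

    -- Since 2 is invertible, a quadratic form is determined by its symmetrized coefficient matrix.
    computes-S2 : ∀ {n g} (G : Fin g → Gate n) →
      (∀ k l → sum (λ t → symmetrize (outer (G t)) k l) ≈ symmetrize [_<_] k l) →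
      S2ComputableWith F n g
    computes-S2 {n} G symmetric-coeffs = circuit G , λ e → begin
      coeff F (circuitPoly F (circuit G)) e ≈⟨ coeff-circuit G e ⟩
      sum (λ t → quadCoeff (outer (G t)) e) ≈⟨ x+x≈y+y⇒x≈y (doubled e) ⟩
      quadCoeff [_<_] e                     ≈⟨ coeff-S2 e ⟨
      coeff F (S2 F n) e                    ∎
      where
      C : Fin n → Fin n → Carrier
      C k l = sum (λ t → outer (G t) k l)
      symmetrize-C : ∀ k l → symmetrize C k l ≈ sum (λ t → symmetrize (outer (G t)) k l)
      symmetrize-C k l = sym (∑-distrib-+ (λ t → outer (G t) k l) (λ t → outer (G t) l k))
      doubled : ∀ e → sum (λ t → quadCoeff (outer (G t)) e) + sum (λ t → quadCoeff (outer (G t)) e)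
                        ≈ quadCoeff [_<_] e + quadCoeff [_<_] e
      doubled e = begin
        sum (λ t → quadCoeff (outer (G t)) e) + sum (λ t → quadCoeff (outer (G t)) e)
          ≈⟨ +-cong (quadCoeff-sum (λ t → outer (G t)) e) (quadCoeff-sum (λ t → outer (G t)) e) ⟩
        quadCoeff C e + quadCoeff C e         ≈⟨ quadCoeff-symmetrize C e ⟨
        quadCoeff (symmetrize C) e            ≈⟨ quadCoeff-cong e (λ k l → trans (symmetrize-C k l) (symmetric-coeffs k l)) ⟩
        quadCoeff (symmetrize [_<_]) e        ≈⟨ quadCoeff-symmetrize [_<_] e ⟩
        quadCoeff [_<_] e + quadCoeff [_<_] e ∎

module Polarization {c ℓ : Level} (F : CommutativeRing c ℓ) where
  open import Data.Nat using (zero; suc)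
  open import Data.Fin as Fin using (Fin; zero; suc)
  import Data.Fin.Properties as Fin
  open import Data.Vec using (lookup)
  open import Data.Product using (_,_)
  open import Data.Bool using (Bool; if_then_else_)
  open import Relation.Nullary using (Dec; does; ¬_)
  open import Function using (_∘_)
  open import Relation.Nullary.Decidable using (dec-true; dec-false)
  open import Relation.Binary.Definitions using (tri<; tri≈; tri>)
  import Relation.Binary.PropositionalEquality as ≡
  import Data.Integer as ℤ

  open CommutativeRing F hiding (zero)
  open import Algebra.Properties.Ring ring using (-0#≈0#)
  open import Algebra.Properties.Semiring.Sum semiring using (sum; sum-cong-≋; sum-replicate-zero; ∑-distrib-+)
  open import Relation.Binary.Reasoning.Setoid setoid
  open ℤ-Solver F using (solve; _:=_; _:+_; _:*_; _:-_; con)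
  open QuadraticCircuits F

  bit : Bool → Carrier
  bit b = if b then 1# else 0#

  bit-true : ∀ {a} {A : Set a} (A? : Dec A) → A → bit (does A?) ≈ 1#
  bit-true A? x = reflexive (≡.cong bit (dec-true A? x))

  bit-false : ∀ {a} {A : Set a} (A? : Dec A) → ¬ A → bit (does A?) ≈ 0#
  bit-false A? ¬x = reflexive (≡.cong bit (dec-false A? ¬x))

  unit : ∀ {n} → Fin n → Fin n → Carrier
  unit k j = bit (does (j Fin.≟ k))

  sum-*-unit : ∀ {n} (f : Fin n → Carrier) k → sum (λ j → f j * unit k j) ≈ f k
  sum-*-unit {suc n} f zero = begin
    f zero * 1# + sum (λ j → f (suc j) * 0#) ≈⟨ +-cong (*-identityʳ _) (sum-cong-≋ {n} (λ j → zeroʳ _)) ⟩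
    f zero + sum {n} (λ _ → 0#)              ≈⟨ +-congˡ (sum-replicate-zero n) ⟩
    f zero + 0#                              ≈⟨ +-identityʳ _ ⟩
    f zero                                   ∎
  sum-*-unit {suc n} f (suc k) = trans (+-cong (zeroʳ _) (sum-*-unit (λ j → f (suc j)) k)) (+-identityˡ _)

  module _ {n : ℕ} where

    eval : LinForm F n → (Fin n → Carrier) → Carrier
    eval L x = sum (λ j → lookup L j * x j)

    evalGate : Gate n → (Fin n → Carrier) → Carrier
    evalGate (L , M) x = eval L x * eval M x

    evalGates : ∀ {g} → (Fin g → Gate n) → (Fin n → Carrier) → Carrier
    evalGates G x = sum (λ t → evalGate (G t) x)

    twiceS2 : (Fin n → Carrier) → Carrier
    twiceS2 x = sum x * sum x - sum (λ j → x j * x j)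

    polar : ((Fin n → Carrier) → Carrier) → Fin n → Fin n → Carrier
    polar V k l = V (λ j → unit k j + unit l j) - V (unit k) - V (unit l)

    eval-unit : ∀ L k → eval L (unit k) ≈ lookup L k
    eval-unit L k = sum-*-unit {n} (lookup L) k

    eval-+ : ∀ L x y → eval L (λ j → x j + y j) ≈ eval L x + eval L y
    eval-+ L x y = trans (sum-cong-≋ {n} (λ j → distribˡ _ _ _)) (∑-distrib-+ {n} _ _)

    polar-evalGate : ∀ G k l → polar (evalGate G) k l ≈ symmetrize (outer G) k l
    polar-evalGate (L , M) k l = begin
      eval L ekl * eval M ekl - eval L ek * eval M ek - eval L el * eval M el
        ≈⟨ +-cong (+-cong (*-cong (eval-+ L ek el) (eval-+ M ek el))
                          (-‿cong (*-cong (eval-unit L k) (eval-unit M k))))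
                  (-‿cong (*-cong (eval-unit L l) (eval-unit M l))) ⟩
      (eval L ek + eval L el) * (eval M ek + eval M el) - Lk * Mk - Ll * Ml
        ≈⟨ +-congʳ (+-congʳ (*-cong (+-cong (eval-unit L k) (eval-unit L l)) (+-cong (eval-unit M k) (eval-unit M l)))) ⟩
      (Lk + Ll) * (Mk + Ml) - Lk * Mk - Ll * Ml
        ≈⟨ solve 4 (λ a b c d → (a :+ b) :* (c :+ d) :- a :* c :- b :* d := a :* d :+ b :* c) refl Lk Ll Mk Ml ⟩
      Lk * Ml + Ll * Mk ∎
      where
      ek el ekl : Fin n → Carrier
      ek = unit k
      el = unit l
      ekl j = unit k j + unit l j
      Lk Ll Mk Ml : Carrier
      Lk = lookup L k
      Ll = lookup L l
      Mk = lookup M k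
      Ml = lookup M l

    polar-cong : ∀ {V W} → (∀ x → V x ≈ W x) → ∀ k l → polar V k l ≈ polar W k l
    polar-cong V≈W k l = +-cong (+-cong (V≈W _) (-‿cong (V≈W _))) (-‿cong (V≈W _))

    polar-evalGates : ∀ {g} (G : Fin g → Gate n) k l → polar (evalGates G) k l ≈ sum (λ t → symmetrize (outer (G t)) k l)
    polar-evalGates {zero} G k l = begin
      0# - 0# - 0# ≈⟨ +-cong (-‿inverseʳ 0#) -0#≈0# ⟩
      0# + 0#      ≈⟨ +-identityʳ 0# ⟩
      0#           ∎
    polar-evalGates {suc g} G k l = begin
      polar (evalGates G) k l
        ≈⟨ solve 6 (λ a b c d e f → (a :+ d) :- (b :+ e) :- (c :+ f) := (a :- b :- c) :+ (d :- e :- f)) refl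
             (evalGate (G zero) ekl) (evalGate (G zero) (unit k)) (evalGate (G zero) (unit l))
             (evalGates (λ t → G (suc t)) ekl) (evalGates (λ t → G (suc t)) (unit k)) (evalGates (λ t → G (suc t)) (unit l)) ⟩
      polar (evalGate (G zero)) k l + polar (evalGates (λ t → G (suc t))) k l
        ≈⟨ +-cong (polar-evalGate (G zero) k l) (polar-evalGates (λ t → G (suc t)) k l) ⟩
      sum (λ t → symmetrize (outer (G t)) k l) ∎
      where
      ekl : Fin n → Carrier
      ekl j = unit k j + unit l j

    sum-unit : ∀ (k : Fin n) → sum (unit k) ≈ 1#
    sum-unit k = trans (sum-cong-≋ {n} (λ j → sym (*-identityˡ _))) (sum-*-unit {n} (λ _ → 1#) k)

    sum-squares-+ : ∀ (x y : Fin n → Carrier) → sum (λ j → (x j + y j) * (x j + y j))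
      ≈ sum (λ j → x j * x j) + (sum (λ j → x j * y j) + sum (λ j → x j * y j)) + sum (λ j → y j * y j)
    sum-squares-+ x y = begin
      sum (λ j → (x j + y j) * (x j + y j))
        ≈⟨ sum-cong-≋ {n} (λ j → solve 2 (λ a b → (a :+ b) :* (a :+ b) := a :* a :+ (a :* b :+ a :* b) :+ b :* b) refl (x j) (y j)) ⟩
      sum (λ j → x j * x j + (x j * y j + x j * y j) + y j * y j)
        ≈⟨ ∑-distrib-+ {n} _ _ ⟩
      sum (λ j → x j * x j + (x j * y j + x j * y j)) + sum (λ j → y j * y j)
        ≈⟨ +-congʳ (trans (∑-distrib-+ {n} _ _) (+-congˡ (∑-distrib-+ {n} _ _))) ⟩
      sum (λ j → x j * x j) + (sum (λ j → x j * y j) + sum (λ j → x j * y j)) + sum (λ j → y j * y j) ∎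

    polar-twiceS2 : ∀ {h} → h * (1# + 1#) ≈ 1# → ∀ k l → polar (λ x → h * twiceS2 x) k l ≈ 1# - unit k l
    polar-twiceS2 {h} h+h≈1 k l = begin
      h * twiceS2 ekl - h * twiceS2 ek - h * twiceS2 el
        ≈⟨ +-congʳ (+-congʳ (*-congˡ (+-cong (*-cong S-ekl S-ekl) (-‿cong (sum-squares-+ ek el))))) ⟩
      h * ((sum ek + sum el) * (sum ek + sum el) - (Q ek + (β + β) + Q el)) - h * twiceS2 ek - h * twiceS2 el
        ≈⟨ solve 6 (λ h s t q r b → h :* ((s :+ t) :* (s :+ t) :- (q :+ (b :+ b) :+ r)) :- h :* (s :* s :- q) :- h :* (t :* t :- r)
                                   := (h :* (con (ℤ.+ 1) :+ con (ℤ.+ 1))) :* (s :* t :- b))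
                 refl h (sum ek) (sum el) (Q ek) (Q el) β ⟩
      (h * (1# + 1#)) * (sum ek * sum el - β)
        ≈⟨ *-cong h+h≈1 (+-cong (*-cong (sum-unit k) (sum-unit l)) (-‿cong (sum-*-unit {n} ek l))) ⟩
      1# * (1# * 1# - unit k l)
        ≈⟨ trans (*-identityˡ _) (+-congʳ (*-identityˡ 1#)) ⟩
      1# - unit k l ∎
      where
      ek el ekl : Fin n → Carrier
      ek = unit k
      el = unit l
      ekl j = unit k j + unit l j
      Q : (Fin n → Carrier) → Carrier
      Q x = sum (λ j → x j * x j)
      β : Carrier
      β = sum (λ j → ek j * el j)
      S-ekl : sum ekl ≈ sum ek + sum el
      S-ekl = ∑-distrib-+ {n} ek el

    symmetrize-[<] : ∀ (k l : Fin n) → symmetrize [_<_] k l ≈ 1# - unit k l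
    symmetrize-[<] k l with Fin.<-cmp k l
    ... | tri< k<l _ l≮k = begin
      [ k < l ] + [ l < k ] ≈⟨ +-cong (bit-true (k Fin.<? l) k<l) (bit-false (l Fin.<? k) l≮k) ⟩
      1# + 0#               ≈⟨ +-congˡ (trans (-‿cong (bit-false (l Fin.≟ k) (Fin.<⇒≢ k<l ∘ ≡.sym))) -0#≈0#) ⟨
      1# - unit k l         ∎
    ... | tri≈ k≮k ≡.refl _ = begin
      [ k < k ] + [ k < k ] ≈⟨ +-cong (bit-false (k Fin.<? k) k≮k) (bit-false (k Fin.<? k) k≮k) ⟩
      0# + 0#               ≈⟨ +-identityʳ 0# ⟩
      0#                    ≈⟨ -‿inverseʳ 1# ⟨
      1# - 1#               ≈⟨ +-congˡ (-‿cong (bit-true (k Fin.≟ k) ≡.refl)) ⟨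
      1# - unit k k         ∎
    ... | tri> k≮l _ l<k = begin
      [ k < l ] + [ l < k ] ≈⟨ +-cong (bit-false (k Fin.<? l) k≮l) (bit-true (l Fin.<? k) l<k) ⟩
      0# + 1#               ≈⟨ +-comm 0# 1# ⟩
      1# + 0#               ≈⟨ +-congˡ (trans (-‿cong (bit-false (l Fin.≟ k) (Fin.<⇒≢ l<k))) -0#≈0#) ⟨
      1# - unit k l         ∎

    computes-S2-of-eval : ∀ {h g} → h * (1# + 1#) ≈ 1# → (G : Fin g → Gate n) →
      (∀ x → evalGates G x ≈ h * twiceS2 x) → S2ComputableWith F n g
    computes-S2-of-eval {h} h+h≈1 G evalGates≈ = computes-S2 h+h≈1 G λ k l → begin
      sum (λ t → symmetrize (outer (G t)) k l) ≈⟨ polar-evalGates G k l ⟨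
      polar (evalGates G) k l                 ≈⟨ polar-cong evalGates≈ k l ⟩
      polar (λ x → h * twiceS2 x) k l         ≈⟨ polar-twiceS2 h+h≈1 k l ⟩
      1# - unit k l                           ≈⟨ symmetrize-[<] k l ⟨
      symmetrize [_<_] k l                    ∎

module Construction {c ℓ : Level} (F : CommutativeRing c ℓ) where
  open import Data.Nat as ℕ using (zero; suc)
  open import Data.Fin using (Fin; zero; suc; _↑ˡ_; _↑ʳ_)
  open import Data.Vec as Vec using ([]; _∷_; _++_; lookup; replicate)
  import Data.Vec.Properties as Vec
  open import Data.Product using (_,_)
  import Data.Integer as ℤ

  open CommutativeRing F hiding (zero)
  open import Algebra.Properties.Ring ring using (-0#≈0#; -‿distribˡ-*; -‿distribʳ-*)
  open import Algebra.Properties.Semiring.Mult semiring using (_×_; ×-congʳ; ×-assoc-*)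
  open import Algebra.Properties.Semiring.Sum semiring
    using (sum; sum-cong-≋; sum-replicate; sum-replicate-zero; ∑-distrib-+; *-distribˡ-sum; *-distribʳ-sum)
  open import Relation.Binary.Reasoning.Setoid setoid
  open ℤ-Solver F using (solve; _:=_; _:+_; _:*_; _:-_; :-_; con)
  open QuadraticCircuits F using (Gate)
  open Polarization F using (eval; evalGate; evalGates; twiceS2; computes-S2-of-eval)

  zeros : ∀ n → LinForm F n
  zeros n = replicate n 0#

  ones : ∀ n → LinForm F n
  ones n = replicate n 1#

  eval-zeros : ∀ n y → eval (zeros n) y ≈ 0#
  eval-zeros n y = trans (sum-cong-≋ {n} (λ j → trans (*-congʳ (reflexive (Vec.lookup-replicate j 0#))) (zeroˡ _)))
    (sum-replicate-zero n)

  eval-ones : ∀ n y → eval (ones n) y ≈ sum y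
  eval-ones n y = sum-cong-≋ {n} (λ j → trans (*-congʳ (reflexive (Vec.lookup-replicate j 1#))) (*-identityˡ _))

  eval-++ : ∀ {m n} (L : LinForm F m) (M : LinForm F n) y →
    eval (L ++ M) y ≈ eval L (λ i → y (i ↑ˡ n)) + eval M (λ i → y (m ↑ʳ i))
  eval-++ [] M y = sym (+-identityˡ _)
  eval-++ (a ∷ L) M y = trans (+-congˡ (eval-++ L M (λ i → y (suc i)))) (sym (+-assoc _ _ _))

  embedˡ : ∀ {m} n → Gate m → Gate (m ℕ.+ n)
  embedˡ n (L , M) = L ++ zeros n , M ++ zeros n

  embedʳ : ∀ m {n} → Gate n → Gate (m ℕ.+ n)
  embedʳ m (L , M) = zeros m ++ L , zeros m ++ M

  evalGate-embedˡ : ∀ {m} n G y → evalGate (embedˡ {m} n G) y ≈ evalGate G (λ i → y (i ↑ˡ n))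
  evalGate-embedˡ n (L , M) y = *-cong (restrict L) (restrict M)
    where
    restrict : ∀ L → eval (L ++ zeros n) y ≈ eval L (λ i → y (i ↑ˡ n))
    restrict L = trans (eval-++ L (zeros n) y) (trans (+-congˡ (eval-zeros n _)) (+-identityʳ _))

  evalGate-embedʳ : ∀ m {n} G y → evalGate (embedʳ m {n} G) y ≈ evalGate G (λ i → y (m ↑ʳ i))
  evalGate-embedʳ m (L , M) y = *-cong (restrict L) (restrict M)
    where
    restrict : ∀ L → eval (zeros m ++ L) y ≈ eval L (λ i → y (m ↑ʳ i))
    restrict L = trans (eval-++ (zeros m) L y) (trans (+-congʳ (eval-zeros m _)) (+-identityˡ _))

  module Blocks (A B : Carrier) (A²+B²≈-1 : A * A + B * B ≈ - 1#) where

    gate₁ gate₂ : Gate 4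
    gate₁ = A ∷ B ∷ - 1# ∷ 0# ∷ [] , A ∷ B ∷ 1# ∷ 0# ∷ []
    gate₂ = B ∷ - A ∷ 0# ∷ - 1# ∷ [] , B ∷ - A ∷ 0# ∷ 1# ∷ []

    -- (A y₀ + B y₁)² + (B y₀ − A y₁)² = (A² + B²)(y₀² + y₁²) = −(y₀² + y₁²).
    evalGate-gate₁+gate₂ : ∀ y → evalGate gate₁ y + evalGate gate₂ y ≈ - sum (λ j → y j * y j)
    evalGate-gate₁+gate₂ y = begin
      evalGate gate₁ y + evalGate gate₂ y
        ≈⟨ solve 6 (λ A B y₀ y₁ y₂ y₃ →
             (A :* y₀ :+ (B :* y₁ :+ (:- con 1ℤ :* y₂ :+ (con 0ℤ :* y₃ :+ con 0ℤ))))
               :* (A :* y₀ :+ (B :* y₁ :+ (con 1ℤ :* y₂ :+ (con 0ℤ :* y₃ :+ con 0ℤ))))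
             :+ (B :* y₀ :+ (:- A :* y₁ :+ (con 0ℤ :* y₂ :+ (:- con 1ℤ :* y₃ :+ con 0ℤ))))
               :* (B :* y₀ :+ (:- A :* y₁ :+ (con 0ℤ :* y₂ :+ (con 1ℤ :* y₃ :+ con 0ℤ))))
             := (A :* A :+ B :* B) :* (y₀ :* y₀ :+ y₁ :* y₁) :- (y₂ :* y₂ :+ y₃ :* y₃))
             refl A B y₀ y₁ y₂ y₃ ⟩
      (A * A + B * B) * (y₀ * y₀ + y₁ * y₁) - (y₂ * y₂ + y₃ * y₃)
        ≈⟨ +-congʳ (*-congʳ A²+B²≈-1) ⟩
      - 1# * (y₀ * y₀ + y₁ * y₁) - (y₂ * y₂ + y₃ * y₃)
        ≈⟨ solve 4 (λ y₀ y₁ y₂ y₃ →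
             :- con 1ℤ :* (y₀ :* y₀ :+ y₁ :* y₁) :- (y₂ :* y₂ :+ y₃ :* y₃)
             := :- (y₀ :* y₀ :+ (y₁ :* y₁ :+ (y₂ :* y₂ :+ (y₃ :* y₃ :+ con 0ℤ)))))
             refl y₀ y₁ y₂ y₃ ⟩
      - sum (λ j → y j * y j) ∎
      where
      1ℤ 0ℤ : ℤ.ℤ
      1ℤ = ℤ.+ 1
      0ℤ = ℤ.+ 0
      y₀ y₁ y₂ y₃ : Carrier
      y₀ = y zero
      y₁ = y (suc zero)
      y₂ = y (suc (suc zero))
      y₃ = y (suc (suc (suc zero)))

    blocks : ∀ t → Fin (t ℕ.* 2) → Gate (t ℕ.* 4)
    blocks (suc t) zero = embedˡ (t ℕ.* 4) gate₁
    blocks (suc t) (suc zero) = embedˡ (t ℕ.* 4) gate₂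
    blocks (suc t) (suc (suc i)) = embedʳ 4 (blocks t i)

    evalGates-blocks : ∀ t y → evalGates (blocks t) y ≈ - sum (λ j → y j * y j)
    evalGates-blocks zero y = sym -0#≈0#
    evalGates-blocks (suc t) y = begin
      evalGate (embedˡ m gate₁) y + (evalGate (embedˡ m gate₂) y + evalGates (λ i → embedʳ 4 (blocks t i)) y)
        ≈⟨ +-cong (evalGate-embedˡ m gate₁ y) (+-cong (evalGate-embedˡ m gate₂ y) rest) ⟩
      evalGate gate₁ head + (evalGate gate₂ head + - sum (λ j → tail j * tail j))
        ≈⟨ sym (+-assoc _ _ _) ⟩
      (evalGate gate₁ head + evalGate gate₂ head) + - sum (λ j → tail j * tail j)
        ≈⟨ +-congʳ (evalGate-gate₁+gate₂ head) ⟩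
      - sum (λ j → head j * head j) + - sum (λ j → tail j * tail j)
        ≈⟨ solve 5 (λ a b c d r → :- (a :+ (b :+ (c :+ (d :+ con (ℤ.+ 0))))) :+ :- r := :- (a :+ (b :+ (c :+ (d :+ r)))))
             refl (y zero * y zero) (y (suc zero) * y (suc zero)) (y (suc (suc zero)) * y (suc (suc zero)))
             (y (suc (suc (suc zero))) * y (suc (suc (suc zero)))) (sum (λ j → tail j * tail j)) ⟩
      - sum (λ j → y j * y j) ∎
      where
      m : ℕ
      m = t ℕ.* 4
      head : Fin 4 → Carrier
      head i = y (i ↑ˡ m)
      tail : Fin m → Carrier
      tail i = y (4 ↑ʳ i)
      rest : evalGates (λ i → embedʳ 4 (blocks t i)) y ≈ - sum (λ j → tail j * tail j)
      rest = trans (sum-cong-≋ {t ℕ.* 2} (λ i → evalGate-embedʳ 4 (blocks t i) y)) (evalGates-blocks t tail)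

    oddGates : ∀ t → Fin (suc (t ℕ.* 2)) → Gate (t ℕ.* 4)
    oddGates t zero = ones (t ℕ.* 4) , ones (t ℕ.* 4)
    oddGates t (suc i) = blocks t i

    evalGates-oddGates : ∀ t y → evalGates (oddGates t) y ≈ twiceS2 y
    evalGates-oddGates t y = +-cong (*-cong (eval-ones _ y) (eval-ones _ y)) (evalGates-blocks t y)

    evenGates : ∀ t → Fin (suc (t ℕ.* 2)) → Gate (suc (t ℕ.* 4))
    evenGates t zero = 0# ∷ ones (t ℕ.* 4) , (1# + 1#) ∷ ones (t ℕ.* 4)
    evenGates t (suc i) = embedʳ 1 (blocks t i)

    -- (Σ y′)(2 y₀ + Σ y′) = (y₀ + Σ y′)² − y₀².
    evalGates-evenGates : ∀ t y → evalGates (evenGates t) y ≈ twiceS2 y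
    evalGates-evenGates t y = begin
      (0# * y zero + eval (ones m) tail) * ((1# + 1#) * y zero + eval (ones m) tail) + evalGates (λ i → embedʳ 1 (blocks t i)) y
        ≈⟨ +-cong (*-cong (+-congˡ (eval-ones m tail)) (+-congˡ (eval-ones m tail)))
                  (trans (sum-cong-≋ {t ℕ.* 2} (λ i → evalGate-embedʳ 1 (blocks t i) y)) (evalGates-blocks t tail)) ⟩
      (0# * y zero + sum tail) * ((1# + 1#) * y zero + sum tail) + - sum (λ j → tail j * tail j)
        ≈⟨ solve 3 (λ y₀ s q → (con (ℤ.+ 0) :* y₀ :+ s) :* ((con (ℤ.+ 1) :+ con (ℤ.+ 1)) :* y₀ :+ s) :+ :- q
                               := (y₀ :+ s) :* (y₀ :+ s) :- (y₀ :* y₀ :+ q))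
             refl (y zero) (sum tail) (sum (λ j → tail j * tail j)) ⟩
      twiceS2 y ∎
      where
      m : ℕ
      m = t ℕ.* 4
      tail : Fin m → Carrier
      tail i = y (suc i)

  shift : ∀ {m} → (Fin (suc m) → Carrier) → Fin m → Carrier
  shift x i = x (suc i) - x zero

  lift : ∀ {m} → LinForm F m → LinForm F (suc m)
  lift L = - sum (lookup L) ∷ L

  eval-lift : ∀ {m} (L : LinForm F m) x → eval (lift L) x ≈ eval L (shift x)
  eval-lift {m} L x = begin
    - sum (lookup L) * x zero + eval L (λ i → x (suc i))
      ≈⟨ +-comm _ _ ⟩
    eval L (λ i → x (suc i)) + - sum (lookup L) * x zero
      ≈⟨ +-congˡ (trans (sym (-‿distribˡ-* _ _)) (-‿distribʳ-* _ _)) ⟩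
    eval L (λ i → x (suc i)) + sum (lookup L) * - x zero
      ≈⟨ +-congˡ (*-distribʳ-sum (- x zero) (lookup L)) ⟩
    eval L (λ i → x (suc i)) + sum (λ i → lookup L i * - x zero)
      ≈⟨ sym (∑-distrib-+ {m} _ _) ⟩
    sum (λ i → lookup L i * x (suc i) + lookup L i * - x zero)
      ≈⟨ sum-cong-≋ {m} (λ i → sym (distribˡ _ _ _)) ⟩
    eval L (shift x) ∎

  scale : ∀ {m} → Carrier → LinForm F m → LinForm F m
  scale h L = Vec.map (h *_) L

  eval-scale : ∀ {m} h (L : LinForm F m) x → eval (scale h L) x ≈ h * eval L x
  eval-scale {m} h L x = trans
    (sum-cong-≋ {m} (λ j → trans (*-congʳ (reflexive (Vec.lookup-map j (h *_) L))) (*-assoc _ _ _)))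
    (sym (*-distribˡ-sum h (λ j → lookup L j * x j)))

  liftGate : ∀ {m} → Carrier → Gate m → Gate (suc m)
  liftGate h (L , M) = scale h (lift L) , lift M

  evalGates-liftGate : ∀ {m g} h (G : Fin g → Gate m) x →
    evalGates (λ t → liftGate h (G t)) x ≈ h * evalGates G (shift x)
  evalGates-liftGate {g = g} h G x = trans (sum-cong-≋ {g} (λ t → evalGate-liftGate (G t))) (sym (*-distribˡ-sum h (λ t → evalGate (G t) (shift x))))
    where
    evalGate-liftGate : ∀ G → evalGate (liftGate h G) x ≈ h * evalGate G (shift x)
    evalGate-liftGate (L , M) = trans (*-cong (trans (eval-scale h (lift L) x) (*-congˡ (eval-lift L x))) (eval-lift M x))
      (*-assoc _ _ _)

  module _ {m} (m×1≈0 : m × 1# ≈ 0#) where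

    sum-const : ∀ u → sum {m} (λ _ → u) ≈ 0#
    sum-const u = begin
      sum {m} (λ _ → u) ≈⟨ sum-replicate m ⟩
      m × u             ≈⟨ ×-congʳ m (*-identityˡ u) ⟨
      m × (1# * u)      ≈⟨ ×-assoc-* m 1# u ⟨
      (m × 1#) * u      ≈⟨ *-congʳ m×1≈0 ⟩
      0# * u            ≈⟨ zeroˡ u ⟩
      0#                ∎

    -- Σ (xᵢ₊₁ − x₀) = Σ xᵢ₊₁ because m = 0 in F; completing the square then absorbs x₀.
    twiceS2-shift : ∀ x → twiceS2 (shift x) ≈ twiceS2 x
    twiceS2-shift x = begin
      sum (shift x) * sum (shift x) - sum (λ i → shift x i * shift x i)
        ≈⟨ +-cong (*-cong sum-shift sum-shift) (-‿cong sum-squares-shift) ⟩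
      sum x′ * sum x′ - (sum (λ i → x′ i * x′ i) + - (z + z) * sum x′)
        ≈⟨ solve 3 (λ z s q → s :* s :- (q :+ :- (z :+ z) :* s) := (z :+ s) :* (z :+ s) :- (z :* z :+ q))
             refl z (sum x′) (sum (λ i → x′ i * x′ i)) ⟩
      twiceS2 x ∎
      where
      z : Carrier
      z = x zero
      x′ : Fin m → Carrier
      x′ i = x (suc i)
      sum-shift : sum (shift x) ≈ sum x′
      sum-shift = trans (∑-distrib-+ {m} x′ (λ _ → - z)) (trans (+-congˡ (sum-const (- z))) (+-identityʳ _))
      sum-squares-shift : sum (λ i → shift x i * shift x i) ≈ sum (λ i → x′ i * x′ i) + - (z + z) * sum x′
      sum-squares-shift = begin
        sum (λ i → shift x i * shift x i)
          ≈⟨ sum-cong-≋ {m} (λ i → solve 2 (λ a z → (a :- z) :* (a :- z) := (a :* a :+ :- (z :+ z) :* a) :+ z :* z) refl (x′ i) z) ⟩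
        sum (λ i → (x′ i * x′ i + - (z + z) * x′ i) + z * z)
          ≈⟨ trans (∑-distrib-+ {m} _ _) (+-cong (∑-distrib-+ {m} _ _) (sum-const (z * z))) ⟩
        (sum (λ i → x′ i * x′ i) + sum (λ i → - (z + z) * x′ i)) + 0#
          ≈⟨ trans (+-identityʳ _) (+-congˡ (sym (*-distribˡ-sum (- (z + z)) x′))) ⟩
        sum (λ i → x′ i * x′ i) + - (z + z) * sum x′ ∎

    computes-S2-by-shift : ∀ {h g} → h * (1# + 1#) ≈ 1# → (G : Fin g → Gate m) →
      (∀ y → evalGates G y ≈ twiceS2 y) → S2ComputableWith F (suc m) g
    computes-S2-by-shift {h} h+h≈1 G evalGates≈ = computes-S2-of-eval h+h≈1 (λ t → liftGate h (G t)) λ x → begin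
      evalGates (λ t → liftGate h (G t)) x ≈⟨ evalGates-liftGate h G x ⟩
      h * evalGates G (shift x)            ≈⟨ *-congˡ (evalGates≈ (shift x)) ⟩
      h * twiceS2 (shift x)                ≈⟨ *-congˡ (twiceS2-shift x) ⟩
      h * twiceS2 x                        ∎

module OddCharacteristic {c ℓ : Level} (F : CommutativeRing c ℓ) (k : ℕ) where
  open import Data.Nat as ℕ using (suc)
  open import Data.Nat.Divisibility using (_∣_; divides)
  open import Data.Nat.Primality using (Prime)
  open import Data.Product using (_,_)
  import Relation.Binary.PropositionalEquality as ≡
  open import Data.Nat.Solver using (module +-*-Solver)
  open +-*-Solver using (_:=_; _:+_; _:*_; con) renaming (solve to solveℕ)

  open CommutativeRing F
  open import Algebra.Properties.Semiring.Mult semiring using (_×_; ×-homo-1; ×-homo-+; ×1-homo-*)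
  open import Relation.Binary.Reasoning.Setoid setoid
  open SquaresModOddPrime k using (P; ∃-∣-sum-of-two-squares+1)
  open Construction F using (module Blocks; computes-S2-by-shift)

  module _ (P×1≈0 : P × 1# ≈ 0#) where

    ∣⇒×1≈0 : ∀ {m} → P ∣ m → m × 1# ≈ 0#
    ∣⇒×1≈0 (divides j ≡.refl) = trans (×1-homo-* j P) (trans (*-congˡ P×1≈0) (zeroʳ _))

    -- 2 (k + 1) = P + 1.
    half : (suc k × 1#) * (1# + 1#) ≈ 1#
    half = begin
      h * (1# + 1#)                ≈⟨ distribˡ h 1# 1# ⟩
      h * 1# + h * 1#              ≈⟨ +-cong (*-identityʳ h) (*-identityʳ h) ⟩
      h + h                        ≈⟨ ×-homo-+ 1# (suc k) (suc k) ⟨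
      (suc k ℕ.+ suc k) × 1#       ≡⟨ ≡.cong (_× 1#) (solveℕ 1 (λ k → (con 1 :+ k) :+ (con 1 :+ k) := con 1 :+ (con 1 :+ k :* con 2)) ≡.refl k) ⟩
      (1 ℕ.+ P) × 1#               ≈⟨ ×-homo-+ 1# 1 P ⟩
      1 × 1# + P × 1#              ≈⟨ +-cong (×-homo-1 1#) P×1≈0 ⟩
      1# + 0#                      ≈⟨ +-identityʳ 1# ⟩
      1#                           ∎
      where
      h : Carrier
      h = suc k × 1#

    sum-of-two-squares≈-1 : ∀ a b → P ∣ a ℕ.* a ℕ.+ b ℕ.* b ℕ.+ 1 →
      (a × 1#) * (a × 1#) + (b × 1#) * (b × 1#) ≈ - 1#
    sum-of-two-squares≈-1 a b P∣ = begin
      A * A + B * B                   ≈⟨ +-identityʳ _ ⟨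
      A * A + B * B + 0#              ≈⟨ +-congˡ (-‿inverseʳ 1#) ⟨
      A * A + B * B + (1# - 1#)       ≈⟨ +-assoc _ 1# (- 1#) ⟨
      (A * A + B * B + 1#) - 1#       ≈⟨ +-congʳ cast ⟨
      (a ℕ.* a ℕ.+ b ℕ.* b ℕ.+ 1) × 1# - 1# ≈⟨ +-congʳ (∣⇒×1≈0 P∣) ⟩
      0# - 1#                         ≈⟨ +-identityˡ _ ⟩
      - 1#                            ∎
      where
      A B : Carrier
      A = a × 1#
      B = b × 1#
      cast : (a ℕ.* a ℕ.+ b ℕ.* b ℕ.+ 1) × 1# ≈ A * A + B * B + 1#
      cast = begin
        (a ℕ.* a ℕ.+ b ℕ.* b ℕ.+ 1) × 1#        ≈⟨ ×-homo-+ 1# (a ℕ.* a ℕ.+ b ℕ.* b) 1 ⟩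
        (a ℕ.* a ℕ.+ b ℕ.* b) × 1# + 1 × 1#     ≈⟨ +-cong (×-homo-+ 1# (a ℕ.* a) (b ℕ.* b)) (×-homo-1 1#) ⟩
        (a ℕ.* a) × 1# + (b ℕ.* b) × 1# + 1#    ≈⟨ +-congʳ (+-cong (×1-homo-* a a) (×1-homo-* b b)) ⟩
        A * A + B * B + 1#                      ∎

  module _ (isField : IsField F) (r : ℕ) (size : HasSize F (P ℕ.^ suc r)) (P-prime : Prime P) where
    open FiniteField F using (characteristic)

    P×1≈0 : P × 1# ≈ 0#
    P×1≈0 = characteristic isField P r size

    computes-S2-odd : ∀ t → P ∣ t ℕ.* 4 → S2ComputableWith F (suc (t ℕ.* 4)) (suc (t ℕ.* 2))
    computes-S2-odd t P∣ with ∃-∣-sum-of-two-squares+1 P-prime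
    ... | a , b , P∣a²+b²+1 = computes-S2-by-shift (∣⇒×1≈0 P×1≈0 P∣) (half P×1≈0) (oddGates t) (evalGates-oddGates t)
      where open Blocks (a × 1#) (b × 1#) (sum-of-two-squares≈-1 P×1≈0 a b P∣a²+b²+1)

    computes-S2-even : ∀ t → P ∣ suc (t ℕ.* 4) → S2ComputableWith F (suc (suc (t ℕ.* 4))) (suc (t ℕ.* 2))
    computes-S2-even t P∣ with ∃-∣-sum-of-two-squares+1 P-prime
    ... | a , b , P∣a²+b²+1 = computes-S2-by-shift (∣⇒×1≈0 P×1≈0 P∣) (half P×1≈0) (evenGates t) (evalGates-evenGates t)
      where open Blocks (a × 1#) (b × 1#) (sum-of-two-squares≈-1 P×1≈0 a b P∣a²+b²+1)


open import Data.Nat using (ℕ; _≤_; _^_; _%_; ⌈_/2⌉; NonZero)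
open import Data.Nat.Primality using (Prime)
open import Data.Product using (Σ; _×_)
open import Relation.Binary.PropositionalEquality using (_≡_)

open import Data.Nat using (zero; suc; _+_; _*_; _/_)
import Data.Nat.Properties as ℕ
open import Data.Nat.DivMod using (m≡m%n+[m/n]*n)
open import Data.Nat.Divisibility using (_∣_; divides)
open import Data.Nat.Solver using (module +-*-Solver)
open import Data.Product using (_,_)
import Relation.Binary.PropositionalEquality as ≡
open +-*-Solver using (solve; _:=_; _:+_; _:*_; con)

⌈1+4t/2⌉≡1+2t : ∀ t → ⌈ suc (t * 4) /2⌉ ≡ suc (t * 2)
⌈1+4t/2⌉≡1+2t zero = ≡.refl
⌈1+4t/2⌉≡1+2t (suc t) = ≡.cong (λ n → suc (suc n)) (⌈1+4t/2⌉≡1+2t t)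

⌈2+4t/2⌉≡1+2t : ∀ t → ⌈ suc (suc (t * 4)) /2⌉ ≡ suc (t * 2)
⌈2+4t/2⌉≡1+2t zero = ≡.refl
⌈2+4t/2⌉≡1+2t (suc t) = ≡.cong (λ n → suc (suc n)) (⌈2+4t/2⌉≡1+2t t)

[1+4t]%2≡1 : ∀ t → suc (t * 4) % 2 ≡ 1
[1+4t]%2≡1 zero = ≡.refl
[1+4t]%2≡1 (suc t) = [1+4t]%2≡1 t

[2+4t]%2≡0 : ∀ t → suc (suc (t * 4)) % 2 ≡ 0
[2+4t]%2≡0 zero = ≡.refl
[2+4t]%2≡0 (suc t) = [2+4t]%2≡0 t

≤1+4t : ∀ t → t ≤ suc (t * 4)
≤1+4t t = ℕ.≤-trans (ℕ.m≤m*n t 4) (ℕ.n≤1+n _)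

UnboundedComputableLengths : ∀ {c ℓ} → CommutativeRing c ℓ → ℕ → Set (c ⊔ ℓ)
UnboundedComputableLengths F b = (m : ℕ) → Σ ℕ λ n → m ≤ n × n % 2 ≡ b × NonZero n × S2ComputableWith F n ⌈ n /2⌉

module PrimeThreeModFour {c ℓ : Level} (F : CommutativeRing c ℓ) (q : ℕ) where
  k P : ℕ
  k = suc (q * 2)
  P = 1 + k * 2

  open OddCharacteristic F k using (computes-S2-odd; computes-S2-even)

  module _ (isField : IsField F) (r : ℕ) (P-size : HasSize F (P ^ suc r)) (P-prime : Prime P) where

    oddLengths : UnboundedComputableLengths F 1
    oddLengths m = suc (t * 4) , m≤n , [1+4t]%2≡1 t , _ ,
      ≡.subst (S2ComputableWith F (suc (t * 4))) (≡.sym (⌈1+4t/2⌉≡1+2t t)) (computes-S2-odd isField r P-size P-prime t P∣4t)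
      where
      t : ℕ
      t = m * P
      P∣4t : P ∣ t * 4
      P∣4t = divides (m * 4) (solve 2 (λ m q → (m :* (con 1 :+ (con 1 :+ q :* con 2) :* con 2)) :* con 4 := (m :* con 4) :* (con 1 :+ (con 1 :+ q :* con 2) :* con 2)) ≡.refl m q)
      m≤n : m ≤ suc (t * 4)
      m≤n = ℕ.≤-trans (ℕ.m≤m*n m P) (≤1+4t t)

    -- 4t + 1 = (4m + 3) P, since 3P ≡ 1 (mod 4).
    evenLengths : UnboundedComputableLengths F 0
    evenLengths m = suc (suc (t * 4)) , m≤n , [2+4t]%2≡0 t , _ ,
      ≡.subst (S2ComputableWith F (suc (suc (t * 4)))) (≡.sym (⌈2+4t/2⌉≡1+2t t)) (computes-S2-even isField r P-size P-prime t P∣1+4t)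
      where
      t : ℕ
      t = m * P + (q * 3 + 2)
      P∣1+4t : P ∣ suc (t * 4)
      P∣1+4t = divides (m * 4 + 3) (solve 2 (λ m q → con 1 :+ (m :* (con 1 :+ (con 1 :+ q :* con 2) :* con 2) :+ (q :* con 3 :+ con 2)) :* con 4
                                                := (m :* con 4 :+ con 3) :* (con 1 :+ (con 1 :+ q :* con 2) :* con 2)) ≡.refl m q)
      m≤n : m ≤ suc (suc (t * 4))
      m≤n = ℕ.≤-trans (ℕ.m≤m*n m P) (ℕ.≤-trans (ℕ.m≤m+n (m * P) _) (ℕ.≤-trans (≤1+4t t) (ℕ.n≤1+n _)))

-- The oddness of r only serves to exclude r = 0.
mainTheorem10 : {c ℓ : Level} (p r : ℕ) → Prime p → p % 4 ≡ 3 → r % 2 ≡ 1 →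
    (F : CommutativeRing c ℓ) → IsField F → HasSize F (p ^ r) →
    ((m : ℕ) → Σ ℕ λ n → m ≤ n × n % 2 ≡ 0 × NonZero n × S2ComputableWith F n ⌈ n /2⌉)
    × ((m : ℕ) → Σ ℕ λ n → m ≤ n × n % 2 ≡ 1 × NonZero n × S2ComputableWith F n ⌈ n /2⌉)
mainTheorem10 p (suc r) p-prime p%4≡3 _ F isField size =
  evenLengths isField r P-size P-prime , oddLengths isField r P-size P-prime
  where
  open PrimeThreeModFour F (p / 4)
  p≡P : p ≡ P
  p≡P = ≡.trans (m≡m%n+[m/n]*n p 4) (≡.trans (≡.cong (_+ p / 4 * 4) p%4≡3)
    (solve 1 (λ q → con 3 :+ q :* con 4 := con 1 :+ (con 1 :+ q :* con 2) :* con 2) ≡.refl (p / 4)))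
  P-prime : Prime P
  P-prime = ≡.subst Prime p≡P p-prime
  P-size : HasSize F (P ^ suc r)
  P-size = ≡.subst (λ n → HasSize F (n ^ suc r)) p≡P size
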